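{- For every $n$ and every $\pi\in S_n$, the bottom pipe dream of $\pi$ is pseudo-Yamanouchi.
   Context: A pipe dream of size $n$ is a tiling of the $n\times n$ grid (rows top to bottom, columns left to right) by cross tiles and elbow tiles (an elbow tile joins north–west and south–east edges) with every position $(i,j)$, $i+j\ge n+1$, an elbow tile. Pipes $1,\dots,n$ enter at the north border (pipe $j$ above column $j$) and exit at the west border; the pipe dream is reduced if no two pipes cross twice, and then its permutation has $\pi(i)$ = label of the pipe exiting row $i$. The bottom pipe dream of $\pi$ is the unique reduced pipe dream with permutation $\pi$ in which, in each row, the cross tiles occupy an initial segment of columns $1,2,\dots,m$ (left-justified). Reading word: scan the pipe dream rows from bottom to top, and within each row from left to right; each cross tile at $(r,c)$ encountered appends $r+c-1$ to a word $\mathbf a=(a_1,\dots,a_\ell)$. Let $\mathrm{cnt}(k,j)$ be the number of occurrences of $j$ among $a_1,\dots,a_k$. The pipe dream is pseudo-Yamanouchi if $1+\mathrm{cnt}(k,j)\ge \mathrm{cnt}(k,j+1)$ for all $1\le k\le\ell$ and $1\le j\le n-2$. -}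

module Defs where

open import Data.Bool using (Bool; true; false; if_then_else_)
open import Data.Nat using (ℕ; zero; suc; _+_; _∸_; _≤_; _⊔_; _⊓_; _≡ᵇ_)
open import Data.Fin using (Fin; toℕ)
open import Data.Fin.Permutation using (Permutation′; _⟨$⟩ʳ_)
open import Data.List using (List; []; _∷_; _++_; concatMap; allFin; reverse; take; length)
open import Data.List.Relation.Unary.Unique.Propositional using (Unique)
open import Data.Vec using (Vec; []; _∷_; tabulate; lookup)
open import Data.Product using (_×_; _,_)
open import Relation.Binary.PropositionalEquality using (_≡_)

-- Conventions: rows and columns are indexed by Fin n (0-based), so the
-- paper's position (i , j) is (toℕ r + 1 , toℕ c + 1).  Pipes are labelled
-- 1 … n (pipe j enters above column j); the label 0 is a dummy used for the
-- edges on the east border (no pipe enters there).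

-- A pipe dream of size n: tile r c ≡ true means a cross tile, false an
-- elbow tile.  Positions with i + j ≥ n + 1 (1-based) must be elbows.
record PipeDream (n : ℕ) : Set where
  field
    tile   : Fin n → Fin n → Bool
    elbows : ∀ (r c : Fin n) → n ≤ toℕ r + toℕ c + 1 → tile r c ≡ false
open PipeDream public

-- Process one row, given the labels of the pipes entering each tile from
-- the north and the label h entering the rightmost tile from the east.
-- Returns: labels leaving each tile to the south, label leaving the row at
-- the west border, and the list of (vertical pipe , horizontal pipe) at
-- each cross tile of the row.
-- Cross: north→south, east→west.  Elbow: north→west, east→south.
rowStep : ∀ {m} → Vec Bool m → Vec ℕ m → ℕ → Vec ℕ m × ℕ × List (ℕ × ℕ)
rowStep [] [] h = [] , h , []
rowStep (b ∷ bs) (t ∷ ts) h with rowStep bs ts h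
... | bots , h′ , cs =
  if b then (t ∷ bots , h′ , (t , h′) ∷ cs) else (h′ ∷ bots , t , cs)

run : ∀ {m k} → Vec (Vec Bool m) k → Vec ℕ m → Vec ℕ k × List (ℕ × ℕ)
run [] tops = [] , []
run (row ∷ rows) tops with rowStep row tops 0
... | bots , e , cs with run rows bots
... | es , cs′ = e ∷ es , cs ++ cs′

rowsOf : ∀ {n} → PipeDream n → Vec (Vec Bool n) n
rowsOf D = tabulate (λ r → tabulate (λ c → tile D r c))

initialLabels : ∀ n → Vec ℕ n
initialLabels n = tabulate (λ (c : Fin n) → suc (toℕ c))

exitLabel : ∀ {n} → PipeDream n → Fin n → ℕ
exitLabel {n} D r with run (rowsOf D) (initialLabels n)
... | es , _ = lookup es r

crossings : ∀ {n} → PipeDream n → List (ℕ × ℕ)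
crossings {n} D with run (rowsOf D) (initialLabels n)
... | _ , cs = Data.List.map (λ { (a , b) → (a ⊓ b , a ⊔ b) }) cs
  where import Data.List

Reduced : ∀ {n} → PipeDream n → Set
Reduced D = Unique (crossings D)

HasPermutation : ∀ {n} → PipeDream n → Permutation′ n → Set
HasPermutation D π = ∀ r → exitLabel D r ≡ suc (toℕ (π ⟨$⟩ʳ r))

LeftJustified : ∀ {n} → PipeDream n → Set
LeftJustified {n} D = ∀ (r c c′ : Fin n) → toℕ c′ ≤ toℕ c →
  tile D r c ≡ true → tile D r c′ ≡ true

IsBottomPipeDream : ∀ {n} → PipeDream n → Permutation′ n → Set
IsBottomPipeDream D π = Reduced D × HasPermutation D π × LeftJustified D

-- reading word: rows bottom to top, each row left to right; a cross at
-- 1-based (i , j) contributes i + j - 1 = toℕ r + toℕ c + 1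
readingWord : ∀ {n} → PipeDream n → List ℕ
readingWord {n} D =
  concatMap (λ r → concatMap (λ c → if tile D r c then (toℕ r + toℕ c + 1) ∷ [] else [])
                             (allFin n))
            (reverse (allFin n))

occ : ℕ → List ℕ → ℕ
occ j [] = 0
occ j (x ∷ xs) = if x ≡ᵇ j then suc (occ j xs) else occ j xs

cnt : List ℕ → ℕ → ℕ → ℕ
cnt a k j = occ j (take k a)

PseudoYamanouchi : ∀ {n} → PipeDream n → Set
PseudoYamanouchi {n} D =
  ∀ (k j : ℕ) → 1 ≤ k → k ≤ length (readingWord D) → 1 ≤ j → j ≤ n ∸ 2 →
    cnt (readingWord D) k (suc j) ≤ 1 + cnt (readingWord D) k j

{-# OPTIONS --safe #-}
module Submission where

-- In a left-justified pipe dream the crosses of row r (0-based) fill its first m columns, so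
-- the row contributes the run of consecutive letters r + 1, r + 2, …, r + m to the reading
-- word.  In a prefix of a concatenation of runs, each letter j + 1 is preceded in its own run
-- by a letter j, except when it starts its run; only row j starts at j + 1, so at every
-- point the letters j + 1 are ahead of the letters j by at most one.

open import Defs
open import Data.Nat using (ℕ)
open import Data.Fin.Permutation using (Permutation′)

open import Data.Bool using (Bool; true; false; if_then_else_)
open import Data.Nat using (zero; suc; _+_; _≤_; _≡ᵇ_; z≤n; s≤s)
open import Data.Nat.Properties
  using ( ≡ᵇ⇒≡; suc-injective; +-comm; +-suc; +-identityʳ; +-monoˡ-≤
        ; n≤1+n; ≤-refl; ≤-trans; ≤-reflexive; module ≤-Reasoning )
open import Data.Fin using (Fin; toℕ; zero; suc)
open import Data.Fin.Properties using (toℕ-injective)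
open import Data.List
  using (List; []; _∷_; _++_; [_]; concat; concatMap; map; tabulate; allFin; reverse)
open import Data.List.Properties using (map-tabulate; reverse-map; unfold-reverse)
open import Data.List.Relation.Unary.All using (All; []; _∷_)
open import Data.List.Relation.Unary.Unique.Propositional using (Unique; []; _∷_)
open import Data.List.Relation.Unary.Unique.Propositional.Properties using (tabulate⁺)
open import Data.List.Relation.Binary.Pointwise as Pointwise using (Pointwise; []; _∷_)
open import Data.Product using (_,_)
open import Data.Empty using (⊥-elim)
open import Function using (_∘_; id)
open import Relation.Binary.PropositionalEquality
  using (_≡_; _≢_; refl; sym; trans; cong; subst; module ≡-Reasoning)

occ-++ : ∀ j xs ys → occ j (xs ++ ys) ≡ occ j xs + occ j ys
occ-++ j [] ys = refl
occ-++ j (x ∷ xs) ys with x ≡ᵇ j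
... | true  = cong suc (occ-++ j xs ys)
... | false = occ-++ j xs ys

occ≤occ-∷ : ∀ j x xs → occ j xs ≤ occ j (x ∷ xs)
occ≤occ-∷ j x xs with x ≡ᵇ j
... | true  = n≤1+n _
... | false = ≤-refl

occ-reverse : ∀ j xs → occ j (reverse xs) ≡ occ j xs
occ-reverse j [] = refl
occ-reverse j (x ∷ xs) = begin
  occ j (reverse (x ∷ xs))         ≡⟨ cong (occ j) (unfold-reverse x xs) ⟩
  occ j (reverse xs ++ [ x ])      ≡⟨ occ-++ j (reverse xs) [ x ] ⟩
  occ j (reverse xs) + occ j [ x ] ≡⟨ cong (_+ occ j [ x ]) (occ-reverse j xs) ⟩
  occ j xs + occ j [ x ]           ≡⟨ +-comm (occ j xs) _ ⟩
  occ j [ x ] + occ j xs           ≡⟨ sym (occ-++ j [ x ] xs) ⟩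
  occ j (x ∷ xs)                   ∎
  where open ≡-Reasoning

occ-absent : ∀ {j xs} → All (j ≢_) xs → occ j xs ≡ 0
occ-absent [] = refl
occ-absent {j} {x ∷ xs} (j≢x ∷ j∉xs) with x ≡ᵇ j | ≡ᵇ⇒≡ x j
... | true  | x≡j = ⊥-elim (j≢x (sym (x≡j _)))
... | false | _   = occ-absent j∉xs

occ-unique≤1 : ∀ {j xs} → Unique xs → occ j xs ≤ 1
occ-unique≤1 [] = z≤n
occ-unique≤1 {j} {x ∷ xs} (x∉xs ∷ unique) with x ≡ᵇ j | ≡ᵇ⇒≡ x j
... | true  | x≡j = s≤s (≤-reflexive (occ-absent (subst (λ y → All (y ≢_) xs) (x≡j _) x∉xs)))
... | false | _   = occ-unique≤1 unique

data Run : ℕ → List ℕ → Set where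
  []  : ∀ {s} → Run s []
  _∷_ : ∀ s {w} → Run (suc s) w → Run s (s ∷ w)

-- Reading the first letter s of a run moves its start to s + 1; as occ (suc j) (suc s ∷ ss)
-- unfolds to the test s ≡ᵇ j, a letter j that is read pays for the j + 1 that may follow it.
run-++-cnt-suc≤ : ∀ j {s w ss ws} → Run s w → Pointwise Run ss ws → ∀ k →
  cnt (w ++ concat ws) k (suc j) ≤ occ (suc j) (s ∷ ss) + cnt (w ++ concat ws) k j
run-++-cnt-suc≤ j [] [] zero    = z≤n
run-++-cnt-suc≤ j [] [] (suc k) = z≤n
run-++-cnt-suc≤ j {s} {ss = ss} [] (run ∷ runs) k =
  ≤-trans (run-++-cnt-suc≤ j run runs k) (+-monoˡ-≤ _ (occ≤occ-∷ (suc j) s ss))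
run-++-cnt-suc≤ j (s ∷ run) runs zero = z≤n
run-++-cnt-suc≤ j (s ∷ run) runs (suc k)
  with s ≡ᵇ suc j | s ≡ᵇ j | run-++-cnt-suc≤ j run runs k
... | true  | true  | ih = s≤s (≤-trans ih (≤-reflexive (sym (+-suc _ _))))
... | true  | false | ih = s≤s ih
... | false | true  | ih = ≤-trans ih (≤-reflexive (sym (+-suc _ _)))
... | false | false | ih = ih

concat-runs-cnt-suc≤ : ∀ j {ss ws} → Pointwise Run ss ws → ∀ k →
  cnt (concat ws) k (suc j) ≤ occ (suc j) ss + cnt (concat ws) k j
concat-runs-cnt-suc≤ j [] zero         = z≤n
concat-runs-cnt-suc≤ j [] (suc k)      = z≤n
concat-runs-cnt-suc≤ j (run ∷ runs) k = run-++-cnt-suc≤ j run runs k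

InitialSegment : ∀ {m} → (Fin m → Bool) → Set
InitialSegment {m} b = ∀ (c c′ : Fin m) → toℕ c′ ≤ toℕ c → b c ≡ true → b c′ ≡ true

initialSegment-suc : ∀ {m} {b : Fin (suc m) → Bool} →
  InitialSegment b → InitialSegment (b ∘ suc)
initialSegment-suc init c c′ c′≤c = init (suc c) (suc c′) (s≤s c′≤c)

initialSegment-empty : ∀ {m} {b : Fin (suc m) → Bool} → InitialSegment b →
  b zero ≡ false → ∀ c → b c ≡ false
initialSegment-empty {b = b} init b₀ c with b c in bc
... | false = refl
... | true  = trans (sym (init c zero z≤n bc)) b₀

crossLetters : ∀ {m} → (Fin m → Bool) → (Fin m → ℕ) → List ℕ
crossLetters b x = concat (tabulate (λ c → if b c then [ x c ] else []))

crossLetters-none : ∀ {m} (b : Fin m → Bool) (x : Fin m → ℕ) →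
  (∀ c → b c ≡ false) → crossLetters b x ≡ []
crossLetters-none {zero}  b x none = refl
crossLetters-none {suc m} b x none rewrite none zero =
  crossLetters-none (b ∘ suc) (x ∘ suc) (none ∘ suc)

crossLetters-run : ∀ {m} (b : Fin m → Bool) (x : Fin m → ℕ) s →
  InitialSegment b → (∀ c → x c ≡ s + toℕ c) → Run s (crossLetters b x)
crossLetters-run {zero}  b x s init x≡ = []
crossLetters-run {suc m} b x s init x≡ with b zero in b₀
... | false
  rewrite crossLetters-none (b ∘ suc) (x ∘ suc) (initialSegment-empty init b₀ ∘ suc) = []
... | true  rewrite x≡ zero | +-identityʳ s =
  s ∷ crossLetters-run (b ∘ suc) (x ∘ suc) (suc s) (initialSegment-suc init)
                       (λ c → trans (x≡ (suc c)) (+-suc s (toℕ c)))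

rowWord : ∀ {n} → PipeDream n → Fin n → List ℕ
rowWord {n} D r = concatMap (λ c → if tile D r c then [ toℕ r + toℕ c + 1 ] else []) (allFin n)

rowWord-run : ∀ {n} (D : PipeDream n) → LeftJustified D →
  ∀ r → Run (suc (toℕ r)) (rowWord D r)
rowWord-run {n} D leftJustified r =
  subst (Run _) (cong concat (sym (map-tabulate id cell)))
    (crossLetters-run (tile D r) _ (suc (toℕ r)) (leftJustified r) (λ c → +-comm _ 1))
  where
  cell : Fin n → List ℕ
  cell c = if tile D r c then [ toℕ r + toℕ c + 1 ] else []

occ-rowStarts≤1 : ∀ n j → occ j (map (suc ∘ toℕ) (reverse (allFin n))) ≤ 1
occ-rowStarts≤1 n j = begin
  occ j (map rowStart (reverse (allFin n))) ≡⟨ cong (occ j) (reverse-map rowStart (allFin n)) ⟩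
  occ j (reverse (map rowStart (allFin n))) ≡⟨ occ-reverse j (map rowStart (allFin n)) ⟩
  occ j (map rowStart (allFin n))           ≡⟨ cong (occ j) (map-tabulate id rowStart) ⟩
  occ j (tabulate rowStart)                 ≤⟨ occ-unique≤1 (tabulate⁺ rowStart-injective) ⟩
  1                                         ∎
  where
  open ≤-Reasoning
  rowStart : Fin n → ℕ
  rowStart = suc ∘ toℕ
  rowStart-injective : ∀ {r r′} → rowStart r ≡ rowStart r′ → r ≡ r′
  rowStart-injective = toℕ-injective ∘ suc-injective

lemma3p2 : ∀ (n : ℕ) (π : Permutation′ n) (D : PipeDream n) →
    IsBottomPipeDream D π → PseudoYamanouchi D
lemma3p2 n π D (_ , _ , leftJustified) k j _ _ _ _ = begin
  cnt (readingWord D) k (suc j)                   ≤⟨ concat-runs-cnt-suc≤ j rowRuns k ⟩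
  occ (suc j) rowStarts + cnt (readingWord D) k j ≤⟨ +-monoˡ-≤ _ (occ-rowStarts≤1 n (suc j)) ⟩
  1 + cnt (readingWord D) k j                     ∎
  where
  open ≤-Reasoning
  rows : List (Fin n)
  rows = reverse (allFin n)
  rowStarts : List ℕ
  rowStarts = map (suc ∘ toℕ) rows
  rowRuns : Pointwise Run rowStarts (map (rowWord D) rows)
  rowRuns = Pointwise.map⁺ _ _ (Pointwise.refl (λ {r} → rowWord-run D leftJustified r))
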